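{- Let $G$ be a connected, non-complete graph of order $n$. Then $1\leq mvd(G)\leq n-\kappa^{+}(G)+1\leq n-\kappa(G)+1$.
   Context: All graphs are finite, simple, undirected and connected. For a graph $G$ with a vertex-coloring (an arbitrary assignment of colors to vertices) and two nonadjacent vertices $x,y$, an $x$-$y$ vertex cut is a set $S\subseteq V(G)\setminus\{x,y\}$ such that $x$ and $y$ lie in different components of $G-S$; it is monochromatic if all vertices of $S$ receive the same color. The coloring is an MVD-coloring if every pair of nonadjacent vertices $x,y$ has a monochromatic $x$-$y$ vertex cut. The monochromatic vertex-disconnection number $mvd(G)$ is the maximum number of colors used by an MVD-coloring of $G$. For nonadjacent $x,y$, $\kappa(x,y)$ denotes the minimum size of an $x$-$y$ vertex cut, and $\kappa^{+}(G)$ denotes the maximum of $\kappa(x,y)$ over all pairs of nonadjacent vertices $x,y$ of $G$. $\kappa(G)$ is the (vertex) connectivity of $G$. -}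

module Defs where

open import Data.Nat using (ℕ; _≤_)
open import Data.Fin using (Fin)
open import Data.Fin.Subset using (Subset; _∈_; _∉_; ∣_∣; ⊥)
open import Data.Bool using (Bool; true; false)
open import Data.Product using (Σ; ∃; ∃-syntax; _×_; _,_)
open import Relation.Binary.PropositionalEquality using (_≡_; _≢_)
open import Relation.Nullary using (¬_)

record Graph (n : ℕ) : Set where
  field
    adj    : Fin n → Fin n → Bool
    sym    : ∀ x y → adj x y ≡ adj y x
    irrefl : ∀ x → adj x x ≡ false
open Graph public

data Reach {n : ℕ} (G : Graph n) (S : Subset n) : Fin n → Fin n → Set where
  here : ∀ {x} → x ∉ S → Reach G S x x
  step : ∀ {x y z} → adj G x y ≡ true → x ∉ S → Reach G S y z → Reach G S x z

Connected : ∀ {n} → Graph n → Set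
Connected {n} G = ∀ (x y : Fin n) → Reach G ⊥ x y

NonAdj : ∀ {n} → Graph n → Fin n → Fin n → Set
NonAdj G x y = (x ≢ y) × (adj G x y ≡ false)

NonComplete : ∀ {n} → Graph n → Set
NonComplete {n} G = ∃[ x ] ∃[ y ] NonAdj G x y

IsCut : ∀ {n} → Graph n → Subset n → Fin n → Fin n → Set
IsCut G S x y = (x ∉ S) × (y ∉ S) × ¬ Reach G S x y

IsMin : (ℕ → Set) → ℕ → Set
IsMin P m = P m × (∀ k → P k → m ≤ k)

IsMax : (ℕ → Set) → ℕ → Set
IsMax P m = P m × (∀ k → P k → k ≤ m)

IsKappaPair : ∀ {n} → Graph n → Fin n → Fin n → ℕ → Set
IsKappaPair {n} G x y = IsMin (λ k → ∃[ S ] IsCut G S x y × ∣ S ∣ ≡ k)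

IsKappaPlus : ∀ {n} → Graph n → ℕ → Set
IsKappaPlus {n} G = IsMax (λ k → ∃[ x ] ∃[ y ] NonAdj G x y × IsKappaPair G x y k)

IsConnectivity : ∀ {n} → Graph n → ℕ → Set
IsConnectivity {n} G = IsMin (λ k → ∃[ S ] (∣ S ∣ ≡ k) × (∃[ x ] ∃[ y ] IsCut G S x y))

-- A coloring of G using exactly k colors: a surjection V(G) → Fin k.
Surjective : ∀ {n k} → (Fin n → Fin k) → Set
Surjective {n} {k} c = ∀ (j : Fin k) → ∃[ v ] c v ≡ j

Monochromatic : ∀ {n k} → (Fin n → Fin k) → Subset n → Set
Monochromatic {n} c S = ∀ (u v : Fin n) → u ∈ S → v ∈ S → c u ≡ c v

IsMVDColoring : ∀ {n k} → Graph n → (Fin n → Fin k) → Set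
IsMVDColoring {n} G c =
  ∀ (x y : Fin n) → NonAdj G x y → ∃[ S ] IsCut G S x y × Monochromatic c S

MVDColorable : ∀ {n} → Graph n → ℕ → Set
MVDColorable {n} G k = ∃[ c ] (Surjective {n} {k} c × IsMVDColoring G c)

IsMvd : ∀ {n} → Graph n → ℕ → Set
IsMvd G = IsMax (MVDColorable G)

module Submission where

-- Take a nonadjacent pair x, y with κ(x,y) = κ⁺(G). An MVD-coloring has a
-- monochromatic x-y cut S, of size at least κ⁺; S carries one colour and each
-- of the other n − ∣S∣ ≤ n − κ⁺ vertices at most one more, so mvd ≤ n − κ⁺ + 1.
-- The one-colour colouring is an MVD-coloring since V ∖ {x,y} separates any
-- nonadjacent x, y, so mvd ≥ 1; and a minimum x-y cut disconnects G, so
-- κ ≤ κ⁺. All predicates involved are decidable over finite data, which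
-- provides the extrema defining mvd, κ⁺ and κ.

open import Defs hiding (sym)
open import Data.Nat using (ℕ; zero; suc; _≤_; _<_; _+_; _∸_; z≤n; s≤s)
import Data.Nat as ℕ
open import Data.Nat.Properties
  using (≤-trans; ≤-reflexive; ≤-pred; n≤0⇒n≡0; <⇒≱; ≮⇒≥; ≤∧≢⇒<; <-irrefl;
         +-suc; +-mono-≤; +-monoʳ-≤; +-monoˡ-≤; +-identityʳ; +-comm;
         m∸n≤m; ∸-monoʳ-≤; m+[n∸m]≡n; module ≤-Reasoning)
open import Data.Nat.Induction using (<-rec)
open import Data.Fin using (Fin; zero; suc; toℕ; fromℕ<) renaming (_≟_ to _≟ᶠ_)
open import Data.Fin.Properties using (any?; all?; ¬∀⟶∃¬; toℕ<n; toℕ-fromℕ<)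
open import Data.Fin.Subset using (Subset; _∈_; _∉_; ∣_∣; ⊥; ⊤; ⁅_⁆; _∪_; ∁; _⊆_)
open import Data.Fin.Subset.Properties
  using (_∈?_; ∣p∣≤n; ∣p∣≤∣x∷p∣; ∉⊥; ∣⊥∣≡0; ∣⊤∣≡n; x∈⁅x⁆; x∈⁅y⁆⇒x≡y; ∣⁅x⁆∣≡1;
         p⊆q⇒∣p∣≤∣q∣; x∉∁p⇒x∈p; x∈∁p⇒x∉p; x∉p⇒x∈∁p; ∣∁p∣≡n∸∣p∣; ∪-identityʳ;
         anySubset?; nonempty?; p⊆p∪q; q⊆p∪q; x∈p∪q⁻)
open import Data.Vec using ([]; _∷_; here; there)
open import Data.Vec.Functional using (head; tail) renaming (_∷_ to _∷ᶠ_)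
open import Data.Bool using (true; false)
open import Data.Bool.Properties using () renaming (_≟_ to _≟ᵇ_)
open import Data.Product using (∃; ∃-syntax; _×_; _,_; proj₁; proj₂; uncurry)
open import Data.Sum using (_⊎_; inj₁; inj₂)
open import Relation.Nullary using (¬_; Dec; yes; no; contradiction)
open import Relation.Nullary.Decidable
  using (_×-dec_; _→-dec_; ¬?; map′; decidable-stable)
open import Relation.Binary.PropositionalEquality
  using (_≡_; _≢_; refl; sym; trans; cong; subst)

module _ {P : ℕ → Set} (P? : ∀ k → Dec (P k)) where

  none-below⇒IsMin : ∀ {a} → P a → (∀ (j : Fin a) → ¬ P (toℕ j)) → IsMin P a
  none-below⇒IsMin pa none = pa , λ k pk →
    ≮⇒≥ (λ k<a → none (fromℕ< k<a) (subst P (sym (toℕ-fromℕ< k<a)) pk))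

  IsMin⇒none-below : ∀ {a} → IsMin P a → ∀ (j : Fin a) → ¬ P (toℕ j)
  IsMin⇒none-below (_ , least) j pj = <⇒≱ (toℕ<n j) (least _ pj)

  none-below? : ∀ a → Dec (∀ (j : Fin a) → ¬ P (toℕ j))
  none-below? a = all? (λ j → ¬? (P? (toℕ j)))

  IsMin? : ∀ a → Dec (IsMin P a)
  IsMin? a = map′ (uncurry none-below⇒IsMin) (λ m → proj₁ m , IsMin⇒none-below m)
                  (P? a ×-dec none-below? a)

  ∃-IsMin : ∀ {a} → P a → ∃ (IsMin P)
  ∃-IsMin {a} = <-rec (λ a → P a → ∃ (IsMin P)) descend a
    where
    descend : ∀ a → (∀ {b} → b < a → P b → ∃ (IsMin P)) → P a → ∃ (IsMin P)
    descend a smaller pa with none-below? a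
    ... | yes none = a , none-below⇒IsMin pa none
    ... | no some with ¬∀⟶∃¬ a _ (λ j → ¬? (P? (toℕ j))) some
    ...   | j , ¬¬pj = smaller (toℕ<n j) (decidable-stable (P? (toℕ j)) ¬¬pj)

  ∃-IsMax : ∀ b → (∀ k → P k → k ≤ b) → ∀ {a} → P a → ∃ (IsMax P)
  ∃-IsMax b bounded pa with P? b
  ... | yes pb = b , pb , bounded
  ∃-IsMax zero bounded pa | no ¬pb = contradiction (subst P (n≤0⇒n≡0 (bounded _ pa)) pa) ¬pb
  ∃-IsMax (suc b) bounded pa | no ¬pb =
    ∃-IsMax b (λ k pk → ≤-pred (≤∧≢⇒< (bounded k pk) (λ { refl → ¬pb pk }))) pa

∃-fun? : ∀ {n k} (P : (Fin n → Fin k) → Set) →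
  (∀ {f g} → (∀ x → f x ≡ g x) → P f → P g) →
  (∀ f → Dec (P f)) → Dec (∃ P)
∃-fun? {zero} P resp P? with P? (λ ())
... | yes p = yes (_ , p)
... | no ¬p = no (λ { (f , pf) → ¬p (resp (λ ()) pf) })
∃-fun? {suc n} P resp P?
  with any? (λ a → ∃-fun? (λ g → P (a ∷ᶠ g))
                      (λ e → resp (λ { zero → refl ; (suc i) → e i }))
                      (λ g → P? (a ∷ᶠ g)))
... | yes (a , g , p) = yes (a ∷ᶠ g , p)
... | no ¬∃ = no (λ { (f , pf) →
        ¬∃ (head f , tail f , resp (λ { zero → refl ; (suc i) → refl }) pf) })

∣p∪q∣≤∣p∣+∣q∣ : ∀ {n} (p q : Subset n) → ∣ p ∪ q ∣ ≤ ∣ p ∣ + ∣ q ∣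
∣p∪q∣≤∣p∣+∣q∣ [] [] = z≤n
∣p∪q∣≤∣p∣+∣q∣ (true ∷ p) (b ∷ q) =
  s≤s (≤-trans (∣p∪q∣≤∣p∣+∣q∣ p q) (+-monoʳ-≤ ∣ p ∣ (∣p∣≤∣x∷p∣ b q)))
∣p∪q∣≤∣p∣+∣q∣ (false ∷ p) (true ∷ q) =
  ≤-trans (s≤s (∣p∪q∣≤∣p∣+∣q∣ p q)) (≤-reflexive (sym (+-suc ∣ p ∣ ∣ q ∣)))
∣p∪q∣≤∣p∣+∣q∣ (false ∷ p) (false ∷ q) = ∣p∪q∣≤∣p∣+∣q∣ p q

∣p∪⁅x⁆∣≡1+∣p∣ : ∀ {n} (p : Subset n) {x} → x ∉ p → ∣ p ∪ ⁅ x ⁆ ∣ ≡ suc ∣ p ∣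
∣p∪⁅x⁆∣≡1+∣p∣ (true ∷ p) {zero} x∉p = contradiction here x∉p
∣p∪⁅x⁆∣≡1+∣p∣ (false ∷ p) {zero} x∉p = cong suc (cong ∣_∣ (∪-identityʳ p))
∣p∪⁅x⁆∣≡1+∣p∣ (true ∷ p) {suc x} x∉p = cong suc (∣p∪⁅x⁆∣≡1+∣p∣ p (λ i → x∉p (there i)))
∣p∪⁅x⁆∣≡1+∣p∣ (false ∷ p) {suc x} x∉p = ∣p∪⁅x⁆∣≡1+∣p∣ p (λ i → x∉p (there i))

∉∪⁅⁆ : ∀ {n} {S : Subset n} {v x} → v ∉ S → v ≢ x → v ∉ S ∪ ⁅ x ⁆
∉∪⁅⁆ {S = S} {x = x} v∉S v≢x v∈ with x∈p∪q⁻ S ⁅ x ⁆ v∈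
... | inj₁ v∈S = v∉S v∈S
... | inj₂ v∈⁅x⁆ = v≢x (x∈⁅y⁆⇒x≡y x v∈⁅x⁆)

∣p∣≤1 : ∀ {n} (p : Subset n) → (∀ {i j} → i ∈ p → j ∈ p → i ≡ j) → ∣ p ∣ ≤ 1
∣p∣≤1 {n} p all-equal with nonempty? p
... | yes (i , i∈p) = ≤-trans (p⊆q⇒∣p∣≤∣q∣ p⊆⁅i⁆) (≤-reflexive (∣⁅x⁆∣≡1 i))
  where
  p⊆⁅i⁆ : p ⊆ ⁅ i ⁆
  p⊆⁅i⁆ j∈p = subst (_∈ ⁅ i ⁆) (all-equal i∈p j∈p) (x∈⁅x⁆ i)
... | no empty = ≤-trans (p⊆q⇒∣p∣≤∣q∣ {q = ⊥} (λ {j} j∈p → contradiction (j , j∈p) empty))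
                         (≤-trans (≤-reflexive (∣⊥∣≡0 n)) z≤n)

image : ∀ {n k} → (Fin n → Fin k) → Subset n → Subset k
image {zero} c [] = ⊥
image {suc n} c (true ∷ p) = ⁅ c zero ⁆ ∪ image (λ i → c (suc i)) p
image {suc n} c (false ∷ p) = image (λ i → c (suc i)) p

∈-image⁺ : ∀ {n k} (c : Fin n → Fin k) p {v} → v ∈ p → c v ∈ image c p
∈-image⁺ c (true ∷ p) here = p⊆p∪q (image (λ i → c (suc i)) p) (x∈⁅x⁆ (c zero))
∈-image⁺ c (true ∷ p) (there v∈p) = q⊆p∪q ⁅ c zero ⁆ _ (∈-image⁺ (λ i → c (suc i)) p v∈p)
∈-image⁺ c (false ∷ p) (there v∈p) = ∈-image⁺ (λ i → c (suc i)) p v∈p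

∈-image⁻ : ∀ {n k} (c : Fin n → Fin k) p {j} → j ∈ image c p → ∃ λ v → v ∈ p × c v ≡ j
∈-image⁻ {zero} c [] j∈ = contradiction j∈ ∉⊥
∈-image⁻ {suc n} c (true ∷ p) j∈ with x∈p∪q⁻ ⁅ c zero ⁆ (image (λ i → c (suc i)) p) j∈
... | inj₁ j∈⁅c0⁆ = zero , here , sym (x∈⁅y⁆⇒x≡y _ j∈⁅c0⁆)
... | inj₂ j∈rest with ∈-image⁻ (λ i → c (suc i)) p j∈rest
...   | v , v∈p , cv≡j = suc v , there v∈p , cv≡j
∈-image⁻ {suc n} c (false ∷ p) j∈ with ∈-image⁻ (λ i → c (suc i)) p j∈
... | v , v∈p , cv≡j = suc v , there v∈p , cv≡j

∣image∣≤ : ∀ {n k} (c : Fin n → Fin k) p → ∣ image c p ∣ ≤ ∣ p ∣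
∣image∣≤ {zero} {k} c [] = ≤-reflexive (∣⊥∣≡0 k)
∣image∣≤ {suc n} c (true ∷ p) =
  ≤-trans (∣p∪q∣≤∣p∣+∣q∣ ⁅ c zero ⁆ (image (λ i → c (suc i)) p))
    (+-mono-≤ (≤-reflexive (∣⁅x⁆∣≡1 (c zero))) (∣image∣≤ (λ i → c (suc i)) p))
∣image∣≤ {suc n} c (false ∷ p) = ∣image∣≤ (λ i → c (suc i)) p

surjective-monochromatic-bound : ∀ {n k} (c : Fin n → Fin k) S →
  Surjective c → Monochromatic c S → k ≤ 1 + (n ∸ ∣ S ∣)
surjective-monochromatic-bound {n} {k} c S surj mono = begin
  k                                     ≡⟨ sym (∣⊤∣≡n k) ⟩
  ∣ ⊤ {k} ∣                             ≤⟨ p⊆q⇒∣p∣≤∣q∣ ⊤⊆images ⟩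
  ∣ image c S ∪ image c (∁ S) ∣         ≤⟨ ∣p∪q∣≤∣p∣+∣q∣ (image c S) (image c (∁ S)) ⟩
  ∣ image c S ∣ + ∣ image c (∁ S) ∣     ≤⟨ +-mono-≤ ∣image-S∣≤1 (∣image∣≤ c (∁ S)) ⟩
  1 + ∣ ∁ S ∣                           ≡⟨ cong suc (∣∁p∣≡n∸∣p∣ S) ⟩
  1 + (n ∸ ∣ S ∣)                       ∎
  where
  open ≤-Reasoning
  ⊤⊆images : ⊤ ⊆ image c S ∪ image c (∁ S)
  ⊤⊆images {j} _ with surj j
  ... | v , refl with v ∈? S
  ...   | yes v∈S = p⊆p∪q (image c (∁ S)) (∈-image⁺ c S v∈S)
  ...   | no v∉S = q⊆p∪q (image c S) _ (∈-image⁺ c (∁ S) (x∉p⇒x∈∁p v∉S))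
  ∣image-S∣≤1 : ∣ image c S ∣ ≤ 1
  ∣image-S∣≤1 = ∣p∣≤1 (image c S) λ i∈ j∈ → same-colour (∈-image⁻ c S i∈) (∈-image⁻ c S j∈)
    where
    same-colour : ∀ {i j} → ∃ (λ u → u ∈ S × c u ≡ i) → ∃ (λ v → v ∈ S × c v ≡ j) → i ≡ j
    same-colour (u , u∈S , refl) (v , v∈S , refl) = mono u v u∈S v∈S

module _ {n : ℕ} (G : Graph n) where

  Reach-source∉ : ∀ {S u y} → Reach G S u y → u ∉ S
  Reach-source∉ (here u∉S) = u∉S
  Reach-source∉ (step _ u∉S _) = u∉S

  Reach-antimono : ∀ {S T u y} → S ⊆ T → Reach G T u y → Reach G S u y
  Reach-antimono S⊆T (here u∉T) = here (λ u∈S → u∉T (S⊆T u∈S))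
  Reach-antimono S⊆T (step a u∉T r) = step a (λ u∈S → u∉T (S⊆T u∈S)) (Reach-antimono S⊆T r)

  -- Cut the walk after its last visit to x.
  Reach-avoid-or-from-neighbour : ∀ {S u y} x → Reach G S u y → y ≢ x →
    Reach G (S ∪ ⁅ x ⁆) u y ⊎ ∃ λ z → adj G x z ≡ true × Reach G (S ∪ ⁅ x ⁆) z y
  Reach-avoid-or-from-neighbour x (here y∉S) y≢x = inj₁ (here (∉∪⁅⁆ y∉S y≢x))
  Reach-avoid-or-from-neighbour x (step {u} {w} a u∉S r) y≢x
    with Reach-avoid-or-from-neighbour x r y≢x
  ... | inj₂ later = inj₂ later
  ... | inj₁ r′ with u ≟ᶠ x
  ...   | yes refl = inj₂ (w , a , r′)
  ...   | no u≢x = inj₁ (step a (∉∪⁅⁆ u∉S u≢x) r′)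

  -- Each step deletes the current vertex, so f = n ∸ ∣ S ∣ bounds the search.
  Reach?-fuel : ∀ f S x y → ∣ S ∣ + f ≡ n → Dec (Reach G S x y)
  Reach?-fuel f S x y size with x ∈? S | x ≟ᶠ y
  ... | yes x∈S | _ = no (λ r → Reach-source∉ r x∈S)
  ... | no x∉S | yes refl = yes (here x∉S)
  Reach?-fuel zero S x y size | no x∉S | no _ =
    contradiction ∣S∣<∣S∣ (<-irrefl refl)
    where
    ∣S∣<∣S∣ : ∣ S ∣ < ∣ S ∣
    ∣S∣<∣S∣ = subst (suc ∣ S ∣ ≤_) (trans (sym size) (+-identityʳ _))
                (subst (_≤ n) (∣p∪⁅x⁆∣≡1+∣p∣ S x∉S) (∣p∣≤n (S ∪ ⁅ x ⁆)))
  Reach?-fuel (suc f) S x y size | no x∉S | no x≢y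
    with any? (λ z → (adj G x z ≟ᵇ true) ×-dec Reach?-fuel f (S ∪ ⁅ x ⁆) z y size′)
    where
    size′ : ∣ S ∪ ⁅ x ⁆ ∣ + f ≡ n
    size′ = trans (cong (_+ f) (∣p∪⁅x⁆∣≡1+∣p∣ S x∉S)) (trans (sym (+-suc ∣ S ∣ f)) size)
  ... | yes (z , a , r) = yes (step a x∉S (Reach-antimono (p⊆p∪q ⁅ x ⁆) r))
  ... | no ¬via = no λ r → via-neighbour (Reach-avoid-or-from-neighbour x r (λ e → x≢y (sym e)))
    where
    via-neighbour : ¬ (Reach G (S ∪ ⁅ x ⁆) x y ⊎
                       ∃ (λ z → adj G x z ≡ true × Reach G (S ∪ ⁅ x ⁆) z y))
    via-neighbour (inj₁ r′) = Reach-source∉ r′ (q⊆p∪q S ⁅ x ⁆ (x∈⁅x⁆ x))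
    via-neighbour (inj₂ e) = ¬via e

  Reach? : ∀ S x y → Dec (Reach G S x y)
  Reach? S x y = Reach?-fuel (n ∸ ∣ S ∣) S x y (m+[n∸m]≡n (∣p∣≤n S))

  IsCut? : ∀ S x y → Dec (IsCut G S x y)
  IsCut? S x y = ¬? (x ∈? S) ×-dec (¬? (y ∈? S) ×-dec ¬? (Reach? S x y))

  NonAdj? : ∀ x y → Dec (NonAdj G x y)
  NonAdj? x y = ¬? (x ≟ᶠ y) ×-dec (adj G x y ≟ᵇ false)

  Monochromatic? : ∀ {k} (c : Fin n → Fin k) S → Dec (Monochromatic c S)
  Monochromatic? c S =
    all? (λ u → all? (λ v → (u ∈? S) →-dec ((v ∈? S) →-dec (c u ≟ᶠ c v))))

  Surjective? : ∀ {k} (c : Fin n → Fin k) → Dec (Surjective c)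
  Surjective? c = all? (λ j → any? (λ v → c v ≟ᶠ j))

  IsMVDColoring? : ∀ {k} (c : Fin n → Fin k) → Dec (IsMVDColoring G c)
  IsMVDColoring? c = all? (λ x → all? (λ y → NonAdj? x y →-dec
                       anySubset? (λ S → IsCut? S x y ×-dec Monochromatic? c S)))

  MVDColoring-resp : ∀ {k} {c d : Fin n → Fin k} → (∀ v → c v ≡ d v) →
    Surjective c × IsMVDColoring G c → Surjective d × IsMVDColoring G d
  MVDColoring-resp c≗d (surj , mvd) = surj′ , mvd′
    where
    surj′ : Surjective _
    surj′ j with surj j
    ... | v , refl = v , sym (c≗d v)
    mvd′ : IsMVDColoring G _
    mvd′ x y xy with mvd x y xy
    ... | S , cut , mono = S , cut , λ u v u∈S v∈S →
      trans (sym (c≗d u)) (trans (mono u v u∈S v∈S) (c≗d v))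

  MVDColorable? : ∀ k → Dec (MVDColorable G k)
  MVDColorable? k = ∃-fun? _ MVDColoring-resp (λ c → Surjective? c ×-dec IsMVDColoring? c)

  IsKappaPair? : ∀ x y k → Dec (IsKappaPair G x y k)
  IsKappaPair? x y = IsMin? (λ k → anySubset? (λ S → IsCut? S x y ×-dec (∣ S ∣ ℕ.≟ k)))

  V∖⁅x,y⁆ : Fin n → Fin n → Subset n
  V∖⁅x,y⁆ x y = ∁ (⁅ x ⁆ ∪ ⁅ y ⁆)

  V∖⁅x,y⁆-isCut : ∀ {x y} → NonAdj G x y → IsCut G (V∖⁅x,y⁆ x y) x y
  V∖⁅x,y⁆-isCut {x} {y} (x≢y , x≁y) =
    (λ x∈ → x∈∁p⇒x∉p x∈ (p⊆p∪q ⁅ y ⁆ (x∈⁅x⁆ x))) ,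
    (λ y∈ → x∈∁p⇒x∉p y∈ (q⊆p∪q ⁅ x ⁆ ⁅ y ⁆ (x∈⁅x⁆ y))) ,
    no-walk
    where
    no-walk : ¬ Reach G (V∖⁅x,y⁆ x y) x y
    no-walk (here _) = x≢y refl
    no-walk (step x~w _ r) with x∈p∪q⁻ ⁅ x ⁆ ⁅ y ⁆ (x∉∁p⇒x∈p (Reach-source∉ r))
    ... | inj₁ w∈⁅x⁆ with x∈⁅y⁆⇒x≡y x w∈⁅x⁆
    ...   | refl = contradiction (trans (sym x~w) (irrefl G x)) λ ()
    no-walk (step x~w _ r) | inj₂ w∈⁅y⁆ with x∈⁅y⁆⇒x≡y y w∈⁅y⁆
    ...   | refl = contradiction (trans (sym x~w) x≁y) λ ()

  ∃-κ-pair : ∀ {x y} → NonAdj G x y → ∃ (IsKappaPair G x y)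
  ∃-κ-pair {x} {y} xy =
    ∃-IsMin (λ k → anySubset? (λ S → IsCut? S x y ×-dec (∣ S ∣ ℕ.≟ k)))
            (V∖⁅x,y⁆ x y , V∖⁅x,y⁆-isCut xy , refl)

  ∃-κ⁺ : NonComplete G → ∃ (IsKappaPlus G)
  ∃-κ⁺ (x , y , xy) =
    ∃-IsMax (λ k → any? (λ x → any? (λ y → NonAdj? x y ×-dec IsKappaPair? x y k)))
      n κ≤n (x , y , xy , proj₂ (∃-κ-pair xy))
    where
    κ≤n : ∀ k → (∃[ x ] ∃[ y ] NonAdj G x y × IsKappaPair G x y k) → k ≤ n
    κ≤n k (_ , _ , _ , (S , _ , ∣S∣≡k) , _) = subst (_≤ n) ∣S∣≡k (∣p∣≤n S)

  disconnecting-set-of-size? : ∀ k →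
    Dec (∃[ S ] (∣ S ∣ ≡ k) × (∃[ x ] ∃[ y ] IsCut G S x y))
  disconnecting-set-of-size? k =
    anySubset? (λ S → (∣ S ∣ ℕ.≟ k) ×-dec any? (λ x → any? (λ y → IsCut? S x y)))

  ∃-κ≤κ⁺ : ∀ {kp} → IsKappaPlus G kp → ∃ λ k → IsConnectivity G k × k ≤ kp
  ∃-κ≤κ⁺ ((x , y , _ , (S , cut , ∣S∣≡kp) , _) , _)
    with ∃-IsMin disconnecting-set-of-size? (S , ∣S∣≡kp , x , y , cut)
  ... | k , κ = k , κ , proj₂ κ _ (S , ∣S∣≡kp , x , y , cut)

  MVDColorable⇒≤n∸κ+1 : ∀ {x y κ j} → NonAdj G x y → IsKappaPair G x y κ →
    MVDColorable G j → j ≤ n ∸ κ + 1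
  MVDColorable⇒≤n∸κ+1 {x} {y} {κ} {j} xy (_ , least) (c , surj , mvd) with mvd x y xy
  ... | S , cut , mono = begin
    j                ≤⟨ surjective-monochromatic-bound c S surj mono ⟩
    1 + (n ∸ ∣ S ∣)  ≤⟨ s≤s (∸-monoʳ-≤ n (least ∣ S ∣ (S , cut , refl))) ⟩
    1 + (n ∸ κ)      ≡⟨ +-comm 1 (n ∸ κ) ⟩
    n ∸ κ + 1        ∎
    where open ≤-Reasoning

  MVDColorable⇒≤n∸κ⁺+1 : ∀ {kp j} → IsKappaPlus G kp → MVDColorable G j → j ≤ n ∸ kp + 1
  MVDColorable⇒≤n∸κ⁺+1 ((_ , _ , xy , κ) , _) = MVDColorable⇒≤n∸κ+1 xy κ

  MVDColorable⇒≤n+1 : ∀ {j} → NonComplete G → MVDColorable G j → j ≤ n + 1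
  MVDColorable⇒≤n+1 (_ , _ , xy) col with ∃-κ-pair xy
  ... | κ , isκ = ≤-trans (MVDColorable⇒≤n∸κ+1 xy isκ col) (+-monoˡ-≤ 1 (m∸n≤m n κ))

  MVDColorable-1 : NonComplete G → MVDColorable G 1
  MVDColorable-1 (x , _) = (λ _ → zero) , (λ { zero → x , refl }) ,
    λ u v uv → V∖⁅x,y⁆ u v , V∖⁅x,y⁆-isCut uv , λ _ _ _ _ → refl

  ∃-mvd : NonComplete G → ∃ λ m → IsMvd G m × 1 ≤ m
  ∃-mvd nc with ∃-IsMax MVDColorable? (n + 1) (λ _ → MVDColorable⇒≤n+1 nc) (MVDColorable-1 nc)
  ... | m , mvd = m , mvd , proj₂ mvd 1 (MVDColorable-1 nc)

theorem1p1 : ∀ {n : ℕ} (G : Graph n) → Connected G → NonComplete G →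
    ∃[ m ] ∃[ kp ] ∃[ k ] IsMvd G m × IsKappaPlus G kp × IsConnectivity G k ×
      (1 ≤ m) × (m ≤ n ∸ kp + 1) × (n ∸ kp + 1 ≤ n ∸ k + 1)
theorem1p1 {n} G _ nc with ∃-mvd G nc | ∃-κ⁺ G nc
... | m , mvd , 1≤m | kp , κ⁺ with ∃-κ≤κ⁺ G κ⁺
...   | k , κ , k≤kp =
  m , kp , k , mvd , κ⁺ , κ , 1≤m ,
  MVDColorable⇒≤n∸κ⁺+1 G κ⁺ (proj₁ mvd) , +-monoˡ-≤ 1 (∸-monoʳ-≤ n k≤kp)
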